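{- Let $m>2$ be an odd integer and $n$ a positive integer. Then $O(m)$ divides $P(m,n)$.
   Context: For an odd integer $m>2$, $O(m)$ denotes the multiplicative order of $2$ modulo $m$ (the least positive $k$ with $2^k\equiv1\pmod m$). For positive integers $m,n$, let $\mathbf{Z}_m$ be the ring of integers modulo $m$ and define $T:\mathbf{Z}_m^n\to\mathbf{Z}_m^n$ by $T(a_0,\dots,a_{n-1})=(a_0+a_1,a_1+a_2,\dots,a_{n-2}+a_{n-1},a_{n-1}+a_0)$. For $\mathbf{a}\in\mathbf{Z}_m^n$, the cycle length of $(T^k\mathbf{a})_{k\ge0}$ is the smallest positive integer $P$ for which there exists $N$ with $T^{k+P}\mathbf{a}=T^k\mathbf{a}$ for all $k\ge N$. The period $P(m,n)$ is the maximum of these cycle lengths over all $\mathbf{a}\in\mathbf{Z}_m^n$. -}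

module Defs where

open import Data.Nat using (ℕ; zero; suc; _+_; _*_; _^_; _≤_; _<_; _≥_; NonZero)
open import Data.Nat.DivMod using (_mod_; _%_)
open import Data.Fin using (Fin; toℕ)
open import Data.Vec using (Vec; lookup; tabulate)
open import Data.Product using (Σ; _×_; ∃)
open import Relation.Binary.PropositionalEquality using (_≡_)

_+ₘ_ : ∀ {m} .{{_ : NonZero m}} → Fin m → Fin m → Fin m
_+ₘ_ {m} a b = (toℕ a + toℕ b) mod m

next : ∀ {n} .{{_ : NonZero n}} → Fin n → Fin n
next {n} i = (suc (toℕ i)) mod n

T : ∀ {m n} .{{_ : NonZero m}} .{{_ : NonZero n}} → Vec (Fin m) n → Vec (Fin m) n
T a = tabulate (λ i → lookup a i +ₘ lookup a (next i))

T^ : ∀ {m n} .{{_ : NonZero m}} .{{_ : NonZero n}} → ℕ → Vec (Fin m) n → Vec (Fin m) n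
T^ zero    a = a
T^ (suc k) a = T (T^ k a)

EventuallyPeriodic : ∀ {m n} .{{_ : NonZero m}} .{{_ : NonZero n}} → Vec (Fin m) n → ℕ → Set
EventuallyPeriodic a P = ∃ λ N → ∀ k → k ≥ N → T^ (k + P) a ≡ T^ k a

IsCycleLength : ∀ {m n} .{{_ : NonZero m}} .{{_ : NonZero n}} → Vec (Fin m) n → ℕ → Set
IsCycleLength a P =
  (0 < P) × EventuallyPeriodic a P × (∀ Q → 0 < Q → EventuallyPeriodic a Q → P ≤ Q)

IsPeriodP : (m n : ℕ) .{{_ : NonZero m}} .{{_ : NonZero n}} → ℕ → Set
IsPeriodP m n P =
  (Σ (Vec (Fin m) n) λ a → IsCycleLength a P) ×
  (∀ (a : Vec (Fin m) n) Q → IsCycleLength a Q → Q ≤ P)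

IsOrder2 : (m : ℕ) .{{_ : NonZero m}} → ℕ → Set
IsOrder2 m k = (0 < k) × (2 ^ k % m ≡ 1 % m) × (∀ j → 0 < j → 2 ^ j % m ≡ 1 % m → k ≤ j)

{-# OPTIONS --safe #-}
-- T is linear over ℤ_m and commutes with cyclic shifts, so T^k a is the cyclic
-- convolution of a with T^k δ₀, where δ₀ = (1, 0, …, 0). Hence every period of δ₀
-- is a period of every orbit, every cycle length divides that of δ₀, and P(m,n) is
-- the cycle length of δ₀. The all-ones vector has the constant iterates 2^k, so
-- 2^(N+P) ≡ 2^N (mod m) for some N; since m is odd, 2 is a unit modulo m, hence
-- 2^P ≡ 1 and O(m) ∣ P.
module Submission where

open import Defs
open import Data.Nat using (ℕ; zero; suc; _+_; _*_; _∸_; _^_; _≤_; _<_; _≥_; _%_; _/_; NonZero; z<s; _<?_; >-nonZero)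
open import Data.Nat.Properties
open import Algebra.Properties.CommutativeSemigroup +-commutativeSemigroup using (x∙yz≈xz∙y; xy∙z≈xz∙y)
open import Data.Nat.DivMod using (_mod_; m≡m%n+[m/n]*n; m%n<n; m%n%n≡m%n; n%n≡0; m<n⇒m%n≡m; [m+n]%n≡m%n; [m+kn]%n≡m%n; %-distribˡ-+; %-distribˡ-*; %-remove-+ˡ)
open import Data.Nat.Divisibility using (_∣_; m%n≡0⇒n∣m; ∣⇒≤)
open import Data.Nat.Induction using (<-rec)
open import Data.Nat.Tactic.RingSolver using (solve-∀)
open import Data.Fin as Fin using (Fin; toℕ; funToFin; finToFun; punchIn)
open import Data.Fin.Properties using (toℕ-injective; toℕ<n; toℕ-fromℕ<; finToFun-funToFin; punchInᵢ≢i; pigeonhole)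
open import Data.Vec using (Vec; lookup; tabulate)
open import Data.Vec.Properties using (lookup∘tabulate; ≡-dec)
open import Data.Vec.Relation.Binary.Pointwise.Extensional using (ext; Pointwise-≡⇒≡)
open import Data.Vec.Functional using (Vector)
open import Algebra.Properties.CommutativeMonoid.Sum +-0-commutativeMonoid using (sum; sum-syntax; sum-remove; sum-cong-≗; sum-replicate-zero; ∑-distrib-+)
open import Data.Product using (Σ; ∃; ∃₂; _×_; _,_)
open import Function using (_∘_)
open import Relation.Nullary using (¬_; yes; no; contradiction)
open import Relation.Nullary.Decidable using (_×-dec_)
open import Relation.Unary using (Decidable)
open import Relation.Binary.PropositionalEquality

LeastPositive : ∀ {ℓ} → (ℕ → Set ℓ) → ℕ → Set ℓ
LeastPositive Pr P = 0 < P × Pr P × (∀ Q → 0 < Q → Pr Q → P ≤ Q)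

Least : ∀ {ℓ} → (ℕ → Set ℓ) → ℕ → Set ℓ
Least Pr a = Pr a × (∀ c → c < a → ¬ Pr c)

least-witness : ∀ {ℓ} {Pr : ℕ → Set ℓ} → Decidable Pr → ∀ b → Pr b → ∃ (Least Pr)
least-witness {Pr = Pr} Pr? = <-rec (λ b → Pr b → ∃ (Least Pr)) search
  where
    search : ∀ b → (∀ {c} → c < b → Pr c → ∃ (Least Pr)) → Pr b → ∃ (Least Pr)
    search b below Prb with anyUpTo? Pr? b
    ... | yes (c , c<b , Prc) = below c<b Prc
    ... | no none = b , Prb , λ c c<b Prc → none (c , c<b , Prc)

leastPositive-∣ : ∀ {ℓ} {Pr : ℕ → Set ℓ} → (∀ P r q → Pr P → Pr (r + q * P) → Pr r) →
                  ∀ {P R} → LeastPositive Pr P → Pr R → P ∣ R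
leastPositive-∣ {Pr = Pr} rem {P@(suc _)} {R} (_ , PrP , least) PrR with R % P in R%P
... | zero = m%n≡0⇒n∣m R P R%P
... | suc r = contradiction (least (suc r) z<s Prr) (<⇒≱ (subst (_< P) R%P (m%n<n R P)))
  where
    Prr : Pr (suc r)
    Prr = subst Pr R%P (rem P (R % P) (R / P) PrP (subst Pr (m≡m%n+[m/n]*n R P) PrR))

module _ {d : ℕ} .{{_ : NonZero d}} where
  open ≡-Reasoning

  %-+-cong : ∀ {a a′ b b′} → a % d ≡ a′ % d → b % d ≡ b′ % d → (a + b) % d ≡ (a′ + b′) % d
  %-+-cong {a} {a′} {b} {b′} a≈a′ b≈b′ = begin
    (a + b) % d            ≡⟨ %-distribˡ-+ a b d ⟩
    (a % d + b % d) % d    ≡⟨ cong₂ (λ x y → (x + y) % d) a≈a′ b≈b′ ⟩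
    (a′ % d + b′ % d) % d  ≡⟨ %-distribˡ-+ a′ b′ d ⟨
    (a′ + b′) % d          ∎

  %-*-cong : ∀ {a a′ b b′} → a % d ≡ a′ % d → b % d ≡ b′ % d → (a * b) % d ≡ (a′ * b′) % d
  %-*-cong {a} {a′} {b} {b′} a≈a′ b≈b′ = begin
    (a * b) % d              ≡⟨ %-distribˡ-* a b d ⟩
    (a % d * (b % d)) % d    ≡⟨ cong₂ (λ x y → (x * y) % d) a≈a′ b≈b′ ⟩
    (a′ % d * (b′ % d)) % d  ≡⟨ %-distribˡ-* a′ b′ d ⟨
    (a′ * b′) % d            ∎

  ≡-%⇒%-≡ : ∀ {a b} → a ≡ b % d → a % d ≡ b % d
  ≡-%⇒%-≡ {b = b} refl = m%n%n≡m%n b d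

  -- For odd d, (d + 1) / 2 is an inverse of 2.
  %-cancelˡ-2 : d % 2 ≡ 1 → ∀ {a b} → (2 * a) % d ≡ (2 * b) % d → a % d ≡ b % d
  %-cancelˡ-2 odd {a} {b} 2a≈2b = begin
    a % d            ≡⟨ halve a ⟨
    (2 * a * h) % d  ≡⟨ %-*-cong 2a≈2b refl ⟩
    (2 * b * h) % d  ≡⟨ halve b ⟩
    b % d            ∎
    where
      double-suc : ∀ q → 2 * suc q ≡ suc (1 + q * 2)
      double-suc = solve-∀
      rearrange : ∀ x y → 2 * x * y ≡ x * (2 * y)
      rearrange = solve-∀
      h : ℕ
      h = suc (d / 2)
      2h≡1+d : 2 * h ≡ suc d
      2h≡1+d = begin
        2 * suc (d / 2)          ≡⟨ double-suc (d / 2) ⟩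
        suc (1 + d / 2 * 2)      ≡⟨ cong (λ r → suc (r + d / 2 * 2)) odd ⟨
        suc (d % 2 + d / 2 * 2)  ≡⟨ cong suc (m≡m%n+[m/n]*n d 2) ⟨
        suc d                    ∎
      halve : ∀ x → (2 * x * h) % d ≡ x % d
      halve x = begin
        (2 * x * h) % d  ≡⟨ cong (_% d) (trans (rearrange x h) (cong (x *_) 2h≡1+d)) ⟩
        (x * suc d) % d  ≡⟨ cong (_% d) (*-suc x d) ⟩
        (x + x * d) % d  ≡⟨ [m+kn]%n≡m%n x x d ⟩
        x % d            ∎

  %-cancelˡ-2^ : d % 2 ≡ 1 → ∀ k {a b} → (2 ^ k * a) % d ≡ (2 ^ k * b) % d → a % d ≡ b % d
  %-cancelˡ-2^ odd zero {a} {b} eq = subst₂ (λ x y → x % d ≡ y % d) (*-identityˡ a) (*-identityˡ b) eq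
  %-cancelˡ-2^ odd (suc k) {a} {b} eq = %-cancelˡ-2^ odd k (%-cancelˡ-2 odd
    (subst₂ (λ x y → x % d ≡ y % d) (*-assoc 2 (2 ^ k) a) (*-assoc 2 (2 ^ k) b) eq))

  2^[r+qP]%d≡1⇒2^r%d≡1 : ∀ P r q → 2 ^ P % d ≡ 1 % d → 2 ^ (r + q * P) % d ≡ 1 % d → 2 ^ r % d ≡ 1 % d
  2^[r+qP]%d≡1⇒2^r%d≡1 P r q 2^P≈1 2^[r+qP]≈1 = begin
    2 ^ r % d                  ≡⟨ cong (_% d) (*-identityʳ (2 ^ r)) ⟨
    (2 ^ r * 1) % d            ≡⟨ %-*-cong {a = 2 ^ r} refl (2^[qP]≈1 q) ⟨
    (2 ^ r * 2 ^ (q * P)) % d  ≡⟨ cong (_% d) (^-distribˡ-+-* 2 r (q * P)) ⟨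
    2 ^ (r + q * P) % d        ≡⟨ 2^[r+qP]≈1 ⟩
    1 % d                      ∎
    where
      2^[qP]≈1 : ∀ q → 2 ^ (q * P) % d ≡ 1 % d
      2^[qP]≈1 zero = refl
      2^[qP]≈1 (suc q) = trans (cong (_% d) (^-distribˡ-+-* 2 P (q * P))) (%-*-cong 2^P≈1 (2^[qP]≈1 q))

  order-∣ : ∀ {o R} → IsOrder2 d o → 2 ^ R % d ≡ 1 % d → o ∣ R
  order-∣ = leastPositive-∣ 2^[r+qP]%d≡1⇒2^r%d≡1

  [i+[d∸i%d]]%d≡0 : ∀ i → (i + (d ∸ i % d)) % d ≡ 0
  [i+[d∸i%d]]%d≡0 i = begin
    (i + (d ∸ i % d)) % d      ≡⟨ %-+-cong {b = d ∸ i % d} (sym (m%n%n≡m%n i d)) refl ⟩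
    (i % d + (d ∸ i % d)) % d  ≡⟨ cong (_% d) (m+[n∸m]≡n (<⇒≤ (m%n<n i d))) ⟩
    d % d                      ≡⟨ n%n≡0 d ⟩
    0                          ∎

  [i+[d∸j]]%d≡0⇒j≡i%d : ∀ i {j} → j < d → (i + (d ∸ j)) % d ≡ 0 → j ≡ i % d
  [i+[d∸j]]%d≡0⇒j≡i%d i {j} j<d d∣i+[d∸j] = begin
    j                      ≡⟨ m<n⇒m%n≡m j<d ⟨
    j % d                  ≡⟨ %-remove-+ˡ j (m%n≡0⇒n∣m _ d d∣i+[d∸j]) ⟨
    (i + (d ∸ j) + j) % d  ≡⟨ cong (_% d) (trans (+-assoc i (d ∸ j) j) (cong (i +_) (m∸n+n≡m (<⇒≤ j<d)))) ⟩
    (i + d) % d            ≡⟨ [m+n]%n≡m%n i d ⟩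
    i % d                  ∎

  sum-%-cong : ∀ {k} (f g : Vector ℕ k) → (∀ j → f j % d ≡ g j % d) → sum f % d ≡ sum g % d
  sum-%-cong {zero} f g f≈g = refl
  sum-%-cong {suc k} f g f≈g = %-+-cong (f≈g Fin.zero) (sum-%-cong (f ∘ Fin.suc) (g ∘ Fin.suc) (f≈g ∘ Fin.suc))

sum-single : ∀ {k} (f : Vector ℕ k) i → (∀ j → j ≢ i → f j ≡ 0) → sum f ≡ f i
sum-single {zero} f ()
sum-single {suc k} f i vanish = begin
  sum f                     ≡⟨ sum-remove {i = i} f ⟩
  f i + sum (f ∘ punchIn i) ≡⟨ cong (f i +_) (sum-cong-≗ (λ j → vanish (punchIn i j) (punchInᵢ≢i i j))) ⟩
  f i + sum {k} (λ _ → 0)   ≡⟨ cong (f i +_) (sum-replicate-zero k) ⟩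
  f i + 0                   ≡⟨ +-identityʳ (f i) ⟩
  f i                       ∎
  where open ≡-Reasoning

module _ {m n : ℕ} .{{_ : NonZero m}} .{{_ : NonZero n}} where
  open ≡-Reasoning

  PeriodicFrom : Vec (Fin m) n → ℕ → ℕ → Set
  PeriodicFrom a N P = ∀ k → k ≥ N → T^ (k + P) a ≡ T^ k a

  T^-+ : ∀ j k (a : Vec (Fin m) n) → T^ (j + k) a ≡ T^ j (T^ k a)
  T^-+ zero    k a = refl
  T^-+ (suc j) k a = cong T (T^-+ j k a)

  periodicFrom-orbit : ∀ {a : Vec (Fin m) n} {s Q} → T^ (s + Q) a ≡ T^ s a → PeriodicFrom a s Q
  periodicFrom-orbit {a} {s} {Q} returns k k≥s = begin
    T^ (k + Q) a              ≡⟨ cong (λ x → T^ (x + Q) a) (m∸n+n≡m k≥s) ⟨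
    T^ (k ∸ s + s + Q) a      ≡⟨ cong (λ x → T^ x a) (+-assoc (k ∸ s) s Q) ⟩
    T^ (k ∸ s + (s + Q)) a    ≡⟨ T^-+ (k ∸ s) (s + Q) a ⟩
    T^ (k ∸ s) (T^ (s + Q) a) ≡⟨ cong (T^ (k ∸ s)) returns ⟩
    T^ (k ∸ s) (T^ s a)       ≡⟨ T^-+ (k ∸ s) s a ⟨
    T^ (k ∸ s + s) a          ≡⟨ cong (λ x → T^ x a) (m∸n+n≡m k≥s) ⟩
    T^ k a                    ∎

  periodicFrom-* : ∀ {a : Vec (Fin m) n} {N P} → PeriodicFrom a N P → ∀ q → PeriodicFrom a N (q * P)
  periodicFrom-* {a} h zero    k k≥N = cong (λ x → T^ x a) (+-identityʳ k)
  periodicFrom-* {a} {N} {P} h (suc q) k k≥N = begin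
    T^ (k + (P + q * P)) a ≡⟨ cong (λ x → T^ x a) (x∙yz≈xz∙y k P (q * P)) ⟩
    T^ (k + q * P + P) a   ≡⟨ h (k + q * P) (≤-trans k≥N (m≤m+n k (q * P))) ⟩
    T^ (k + q * P) a       ≡⟨ periodicFrom-* h q k k≥N ⟩
    T^ k a                 ∎

  periodicFrom-rem : ∀ {a : Vec (Fin m) n} {N N′ P r q} → PeriodicFrom a N P → PeriodicFrom a N′ (r + q * P) →
                     PeriodicFrom a (N + N′) r
  periodicFrom-rem {a} {N} {N′} {P} {r} {q} hP hrqP k k≥N+N′ = begin
    T^ (k + r) a             ≡⟨ periodicFrom-* hP q (k + r) (≤-trans (≤-trans (m≤m+n N N′) k≥N+N′) (m≤m+n k r)) ⟨
    T^ (k + r + q * P) a     ≡⟨ cong (λ x → T^ x a) (+-assoc k r (q * P)) ⟩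
    T^ (k + (r + q * P)) a   ≡⟨ hrqP k (≤-trans (m≤n+m N′ N) k≥N+N′) ⟩
    T^ k a                   ∎

  -- Multiples of a positive period R reach past any threshold N, so a period Q
  -- valid from N is already valid from the earlier threshold s.
  periodicFrom-earlier : ∀ {a : Vec (Fin m) n} {s R N Q} → 0 < R → PeriodicFrom a s R → PeriodicFrom a N Q →
                         PeriodicFrom a s Q
  periodicFrom-earlier {a} {s} {R} {N} {Q} R>0 hR hQ k k≥s = begin
    T^ (k + Q) a             ≡⟨ periodicFrom-* hR N (k + Q) (≤-trans k≥s (m≤m+n k Q)) ⟨
    T^ (k + Q + N * R) a     ≡⟨ cong (λ x → T^ x a) (xy∙z≈xz∙y k Q (N * R)) ⟩
    T^ (k + N * R + Q) a     ≡⟨ hQ (k + N * R) (≤-trans (m≤m*n N R {{>-nonZero R>0}}) (m≤n+m (N * R) k)) ⟩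
    T^ (k + N * R) a         ≡⟨ periodicFrom-* hR N k k≥s ⟩
    T^ k a                   ∎

  cycleLength-∣ : ∀ {a : Vec (Fin m) n} {P R} → IsCycleLength a P → EventuallyPeriodic a R → P ∣ R
  cycleLength-∣ = leastPositive-∣ λ _ _ q (N , hP) (N′ , hrqP) → N + N′ , periodicFrom-rem {q = q} hP hrqP

  orbit-collision : (a : Vec (Fin m) n) → ∃₂ λ s t → s < t × T^ s a ≡ T^ t a
  orbit-collision a with pigeonhole (n<1+n (m ^ n)) (λ i → funToFin (lookup (T^ (toℕ i) a)))
  ... | i , j , i<j , same-code = toℕ i , toℕ j , i<j , funToFin∘lookup-injective same-code
    where
      funToFin∘lookup-injective : ∀ {v w : Vec (Fin m) n} → funToFin (lookup v) ≡ funToFin (lookup w) → v ≡ w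
      funToFin∘lookup-injective {v} {w} e = Pointwise-≡⇒≡ (ext λ t → begin
        lookup v t                          ≡⟨ finToFun-funToFin (lookup v) t ⟨
        finToFun (funToFin (lookup v)) t    ≡⟨ cong (λ c → finToFun c t) e ⟩
        finToFun (funToFin (lookup w)) t    ≡⟨ finToFun-funToFin (lookup w) t ⟩
        lookup w t                          ∎)

  cycleLength-exists : (a : Vec (Fin m) n) → Σ ℕ (IsCycleLength a)
  cycleLength-exists a with orbit-collision a
  ... | s , t , s<t , collide with least-witness returns? (t ∸ s) (m<n⇒0<n∸m s<t , returns-after-t∸s)
    where
      Returns : ℕ → Set
      Returns Q = 0 < Q × T^ (s + Q) a ≡ T^ s a
      returns? : Decidable Returns
      returns? Q = 0 <? Q ×-dec ≡-dec Fin._≟_ (T^ (s + Q) a) (T^ s a)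
      returns-after-t∸s : T^ (s + (t ∸ s)) a ≡ T^ s a
      returns-after-t∸s = trans (cong (λ x → T^ x a) (m+[n∸m]≡n (<⇒≤ s<t))) (sym collide)
  ... | Q , (Q>0 , returns) , none-earlier = Q , Q>0 , (s , periodicFrom-orbit returns) , minimal
    where
      minimal : ∀ Q′ → 0 < Q′ → EventuallyPeriodic a Q′ → Q ≤ Q′
      minimal Q′ Q′>0 (N , h) = ≮⇒≥ λ Q′<Q → none-earlier Q′ Q′<Q
        (Q′>0 , periodicFrom-earlier Q>0 (periodicFrom-orbit returns) h s ≤-refl)

  _!_ : Vec (Fin m) n → ℕ → ℕ
  v ! i = toℕ (lookup v (i mod n))

  ≡-from-! : ∀ {v w : Vec (Fin m) n} → (∀ i → v ! i ≡ w ! i) → v ≡ w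
  ≡-from-! {v} {w} v≗w = Pointwise-≡⇒≡ (ext λ t → toℕ-injective (begin
    toℕ (lookup v t)  ≡⟨ cong (toℕ ∘ lookup v) (mod-toℕ t) ⟨
    v ! toℕ t         ≡⟨ v≗w (toℕ t) ⟩
    w ! toℕ t         ≡⟨ cong (toℕ ∘ lookup w) (mod-toℕ t) ⟩
    toℕ (lookup w t)  ∎))
    where
      mod-toℕ : (t : Fin n) → toℕ t mod n ≡ t
      mod-toℕ t = toℕ-injective (trans (toℕ-fromℕ< _) (m<n⇒m%n≡m (toℕ<n t)))

  !-T : ∀ v i → T v ! i ≡ (v ! i + v ! suc i) % m
  !-T v i = begin
    toℕ (lookup (T v) (i mod n))                          ≡⟨ cong toℕ (lookup∘tabulate _ (i mod n)) ⟩
    toℕ (lookup v (i mod n) +ₘ lookup v (next (i mod n))) ≡⟨ toℕ-fromℕ< _ ⟩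
    (v ! i + toℕ (lookup v (next (i mod n)))) % m         ≡⟨ cong (λ t → (v ! i + toℕ (lookup v t)) % m) next-mod ⟩
    (v ! i + v ! suc i) % m                               ∎
    where
      next-mod : next (i mod n) ≡ suc i mod n
      next-mod = toℕ-injective (begin
        toℕ (next (i mod n))     ≡⟨ toℕ-fromℕ< _ ⟩
        suc (toℕ (i mod n)) % n  ≡⟨ cong (λ x → suc x % n) (toℕ-fromℕ< _) ⟩
        suc (i % n) % n          ≡⟨ %-+-cong {a = 1} refl (m%n%n≡m%n i n) ⟩
        suc i % n                ≡⟨ toℕ-fromℕ< _ ⟨
        toℕ (suc i mod n)        ∎)

  δ : ℕ → ℕ
  δ zero    = 1
  δ (suc _) = 0

  δ₀ : Vec (Fin m) n
  δ₀ = tabulate (λ t → δ (toℕ t) mod m)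

  δ₀-! : ∀ i → δ₀ ! i ≡ δ (i % n) % m
  δ₀-! i = begin
    toℕ (lookup δ₀ (i mod n))        ≡⟨ cong toℕ (lookup∘tabulate _ (i mod n)) ⟩
    toℕ (δ (toℕ (i mod n)) mod m)    ≡⟨ toℕ-fromℕ< _ ⟩
    δ (toℕ (i mod n)) % m            ≡⟨ cong (λ x → δ x % m) (toℕ-fromℕ< _) ⟩
    δ (i % n) % m                    ∎

  -- Cyclic convolution Σ_j v_j w_{i-j}, with i - j written i + (n ∸ j) to avoid truncated subtraction.
  _⊛_ : Vec (Fin m) n → Vec (Fin m) n → ℕ → ℕ
  (v ⊛ w) i = ∑[ j < n ] (toℕ (lookup v j) * w ! (i + (n ∸ toℕ j)))

  ⊛-δ₀ : ∀ v i → (v ⊛ δ₀) i % m ≡ v ! i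
  ⊛-δ₀ v i = begin
    (v ⊛ δ₀) i % m
      ≡⟨ sum-%-cong _ _ (λ j → %-*-cong {a = c j} refl (≡-%⇒%-≡ (δ₀-! (x j)))) ⟩
    (∑[ j < n ] (c j * δ (x j % n))) % m
      ≡⟨ cong (_% m) (sum-single (λ j → c j * δ (x j % n)) (i mod n) off-diagonal) ⟩
    (v ! i * δ ((i + (n ∸ toℕ (i mod n))) % n)) % m
      ≡⟨ cong (λ r → (v ! i * δ ((i + (n ∸ r)) % n)) % m) (toℕ-fromℕ< (m%n<n i n)) ⟩
    (v ! i * δ ((i + (n ∸ i % n)) % n)) % m
      ≡⟨ cong (λ y → (v ! i * δ y) % m) ([i+[d∸i%d]]%d≡0 i) ⟩
    (v ! i * 1) % m
      ≡⟨ cong (_% m) (*-identityʳ (v ! i)) ⟩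
    v ! i % m
      ≡⟨ m<n⇒m%n≡m (toℕ<n _) ⟩
    v ! i
      ∎
    where
      c : Fin n → ℕ
      c j = toℕ (lookup v j)
      x : Fin n → ℕ
      x j = i + (n ∸ toℕ j)
      off-diagonal : ∀ j → j ≢ i mod n → c j * δ (x j % n) ≡ 0
      off-diagonal j j≢i with x j % n in x%n
      ... | zero  = contradiction (toℕ-injective (trans ([i+[d∸j]]%d≡0⇒j≡i%d i (toℕ<n j) x%n) (sym (toℕ-fromℕ< _)))) j≢i
      ... | suc _ = *-zeroʳ (c j)

  ⊛-T : ∀ v w i → (v ⊛ T w) i % m ≡ ((v ⊛ w) i + (v ⊛ w) (suc i)) % m
  ⊛-T v w i = begin
    (v ⊛ T w) i % m
      ≡⟨ sum-%-cong _ _ (λ j → %-*-cong {a = c j} refl (≡-%⇒%-≡ (!-T w (x j)))) ⟩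
    (∑[ j < n ] (c j * (w ! x j + w ! suc (x j)))) % m
      ≡⟨ cong (_% m) (sum-cong-≗ (λ j → *-distribˡ-+ (c j) (w ! x j) (w ! suc (x j)))) ⟩
    (∑[ j < n ] (c j * w ! x j + c j * w ! suc (x j))) % m
      ≡⟨ cong (_% m) (∑-distrib-+ (λ j → c j * w ! x j) (λ j → c j * w ! suc (x j))) ⟩
    ((v ⊛ w) i + (v ⊛ w) (suc i)) % m
      ∎
    where
      c : Fin n → ℕ
      c j = toℕ (lookup v j)
      x : Fin n → ℕ
      x j = i + (n ∸ toℕ j)

  T^-⊛ : ∀ v k i → T^ k v ! i ≡ (v ⊛ T^ k δ₀) i % m
  T^-⊛ v zero    i = sym (⊛-δ₀ v i)
  T^-⊛ v (suc k) i = begin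
    T (T^ k v) ! i                              ≡⟨ !-T (T^ k v) i ⟩
    (T^ k v ! i + T^ k v ! suc i) % m           ≡⟨ %-+-cong (≡-%⇒%-≡ (T^-⊛ v k i)) (≡-%⇒%-≡ (T^-⊛ v k (suc i))) ⟩
    ((v ⊛ w) i + (v ⊛ w) (suc i)) % m           ≡⟨ ⊛-T v w i ⟨
    (v ⊛ T w) i % m                             ∎
    where
      w : Vec (Fin m) n
      w = T^ k δ₀

  T^-δ₀-determines : ∀ (v : Vec (Fin m) n) {j k} → T^ j δ₀ ≡ T^ k δ₀ → T^ j v ≡ T^ k v
  T^-δ₀-determines v {j} {k} eq = ≡-from-! λ i → begin
    T^ j v ! i                ≡⟨ T^-⊛ v j i ⟩
    (v ⊛ T^ j δ₀) i % m       ≡⟨ cong (λ w → (v ⊛ w) i % m) eq ⟩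
    (v ⊛ T^ k δ₀) i % m       ≡⟨ T^-⊛ v k i ⟨
    T^ k v ! i                ∎

  eventuallyPeriodic-from-δ₀ : ∀ (v : Vec (Fin m) n) {P} → EventuallyPeriodic δ₀ P → EventuallyPeriodic v P
  eventuallyPeriodic-from-δ₀ v {P} (N , h) = N , λ k k≥N → T^-δ₀-determines v {k + P} {k} (h k k≥N)

  𝟙 : Vec (Fin m) n
  𝟙 = tabulate (λ _ → 1 mod m)

  T^-𝟙 : ∀ k i → T^ k 𝟙 ! i ≡ 2 ^ k % m
  T^-𝟙 zero    i = trans (cong toℕ (lookup∘tabulate _ (i mod n))) (toℕ-fromℕ< _)
  T^-𝟙 (suc k) i = begin
    T (T^ k 𝟙) ! i                        ≡⟨ !-T (T^ k 𝟙) i ⟩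
    (T^ k 𝟙 ! i + T^ k 𝟙 ! suc i) % m     ≡⟨ %-+-cong (≡-%⇒%-≡ (T^-𝟙 k i)) (≡-%⇒%-≡ (T^-𝟙 k (suc i))) ⟩
    (2 ^ k + 2 ^ k) % m                   ≡⟨ cong (λ x → (2 ^ k + x) % m) (+-identityʳ (2 ^ k)) ⟨
    2 ^ suc k % m                         ∎

  period-𝟙⇒2^P≡1 : m % 2 ≡ 1 → ∀ {P} → EventuallyPeriodic 𝟙 P → 2 ^ P % m ≡ 1 % m
  period-𝟙⇒2^P≡1 odd {P} (N , h) = %-cancelˡ-2^ odd N (begin
    (2 ^ N * 2 ^ P) % m   ≡⟨ cong (_% m) (^-distribˡ-+-* 2 N P) ⟨
    2 ^ (N + P) % m       ≡⟨ T^-𝟙 (N + P) 0 ⟨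
    T^ (N + P) 𝟙 ! 0      ≡⟨ cong (_! 0) (h N ≤-refl) ⟩
    T^ N 𝟙 ! 0            ≡⟨ T^-𝟙 N 0 ⟩
    2 ^ N % m             ≡⟨ cong (_% m) (*-identityʳ (2 ^ N)) ⟨
    (2 ^ N * 1) % m       ∎)

  periodP-δ₀ : ∀ {P} → IsPeriodP m n P → EventuallyPeriodic δ₀ P
  periodP-δ₀ {P} ((a , cycle-a) , maximal) with cycleLength-exists δ₀
  ... | Q , cycle-δ₀@(Q>0 , δ₀-periodic , _) = subst (EventuallyPeriodic δ₀) (sym P≡Q) δ₀-periodic
    where
      P≡Q : P ≡ Q
      P≡Q = ≤-antisym (∣⇒≤ {{>-nonZero Q>0}} (cycleLength-∣ cycle-a (eventuallyPeriodic-from-δ₀ a δ₀-periodic)))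
                      (maximal δ₀ Q cycle-δ₀)

proposition4p3 : (m n : ℕ) .{{_ : NonZero m}} .{{_ : NonZero n}} →
    m % 2 ≡ 1 → 2 < m → 0 < n →
    (o P : ℕ) → IsOrder2 m o → IsPeriodP m n P → o ∣ P
proposition4p3 m n odd _ _ o P order period =
  order-∣ order (period-𝟙⇒2^P≡1 odd (eventuallyPeriodic-from-δ₀ 𝟙 (periodP-δ₀ period)))
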